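{- Let $n$ be a positive integer and let $M$ be obtained by applying a row permutation and a column permutation to $L_n$. Then there exists a set $S$ of positions $(i,j)$ at which $M$ has entry $0$, such that $|S|=O(n)$ and the following holds: $M$ is the unique matrix among all row-and-column permutations of $L_n$ whose entries at all positions in $S$ are $0$.
   Context: $L_n$ is the $n\times n$ 0-1 matrix with $L_n(i,j)=1$ iff $i\ge j$ (ones on and below the main diagonal, zeros above). -}

module Defs where

open import Data.Nat using (ℕ)
open import Data.Bool using (Bool)
open import Data.Fin using (Fin; _≤?_)
open import Data.Fin.Permutation using (Permutation′; _⟨$⟩ʳ_)
open import Relation.Nullary.Decidable using (⌊_⌋)

-- 0-1 matrices encoded with Bool: true = 1, false = 0.
Matrix : ℕ → Set
Matrix n = Fin n → Fin n → Bool

L : (n : ℕ) → Matrix n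
L n i j = ⌊ j ≤? i ⌋

permL : (n : ℕ) → Permutation′ n → Permutation′ n → Matrix n
permL n σ τ i j = L n (σ ⟨$⟩ʳ i) (τ ⟨$⟩ʳ j)

{-# OPTIONS --safe #-}
-- Sorting rows by σ and columns by τ turns M into L_n, whose zeros form the strict upper
-- triangle; the certificate is its first two superdiagonals (k, k+1) and (k, k+2), fewer
-- than 2n positions. If L_n permuted by σ′, τ′ vanishes there, then f = σ′σ⁻¹ and
-- g = τ′τ⁻¹ satisfy f k < g l whenever k < l ≤ k + 2. By induction on m, f and g fix every
-- point below m: were g⁻¹ m beyond m, the row just before it would have f-value below m;
-- were g⁻¹ (m + 1) beyond m + 1, the two rows just before it would both have f-value m.
module Submission where

open import Defs
open import Data.Nat using (ℕ; _≤_; _*_)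
open import Data.Bool using (false)
open import Data.Fin using (Fin)
open import Data.Fin.Permutation using (Permutation′)
open import Data.List using (List; length)
open import Data.List.Relation.Unary.All using (All)
open import Data.Product using (_×_; _,_; ∃; ∃-syntax; proj₁; proj₂)
open import Relation.Binary.PropositionalEquality using (_≡_)

open import Data.Nat using (zero; suc; _+_; _<_; _<?_; z≤n; s≤s; s≤s⁻¹; z<s; s<s)
import Data.Nat.Properties as ℕ
open import Data.Fin as Fin using (toℕ; pred; fromℕ<; _≤?_)
open import Data.Fin.Properties using (toℕ-injective; toℕ-inject₁; toℕ-fromℕ<; toℕ<n)
open import Data.Fin.Permutation
  using (_⟨$⟩ʳ_; _⟨$⟩ˡ_; inverseˡ; inverseʳ; flip; _∘ₚ_; id; _≈_)
open import Data.List using ([]; _∷_; map)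
open import Data.List.Properties using (length-map)
open import Data.List.Membership.Propositional using (_∈_)
open import Data.List.Membership.Propositional.Properties using (∈-map⁺)
open import Data.List.Relation.Unary.Any using (here; there)
open import Data.List.Relation.Unary.All using ([]; _∷_)
import Data.List.Relation.Unary.All as All
open import Data.List.Relation.Unary.All.Properties using (map⁺; map⁻)
import Data.Product as Product
open import Data.Sum using (inj₁; inj₂)
open import Function.Bundles using (Injection)
open import Function.Properties.Inverse using (↔⇒↣)
open import Relation.Nullary using (yes; no; contradiction)
open import Relation.Binary.PropositionalEquality
  using (refl; sym; trans; cong; cong₂; subst; module ≡-Reasoning)

<⇒L≡false : ∀ {n} {i j : Fin n} → toℕ i < toℕ j → L n i j ≡ false
<⇒L≡false {i = i} {j} i<j with j ≤? i
... | yes j≤i = contradiction j≤i (ℕ.<⇒≱ i<j)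
... | no _    = refl

L≡false⇒< : ∀ {n} {i j : Fin n} → L n i j ≡ false → toℕ i < toℕ j
L≡false⇒< {i = i} {j} eq with j ≤? i
L≡false⇒< {i = i} {j} () | yes _
... | no j≰i = ℕ.≰⇒> j≰i

Near : ∀ {n} → Fin n → Fin n → Set
Near k l = toℕ k < toℕ l × toℕ l ≤ 2 + toℕ k

near-by-one : ∀ {n} {k l : Fin n} → suc (toℕ k) ≡ toℕ l → Near k l
near-by-one {k = k} e =
  subst (λ t → toℕ k < t × t ≤ 2 + toℕ k) e (ℕ.n<1+n _ , ℕ.n≤1+n _)

near-by-two : ∀ {n} {k l : Fin n} → 2 + toℕ k ≡ toℕ l → Near k l
near-by-two {k = k} e =
  subst (λ t → toℕ k < t × t ≤ 2 + toℕ k) e (ℕ.m<n⇒m<1+n (ℕ.n<1+n _) , ℕ.≤-refl)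

suc-toℕ-pred : ∀ {n} (x : Fin n) → 0 < toℕ x → suc (toℕ (pred x)) ≡ toℕ x
suc-toℕ-pred (Fin.suc x) _ = cong suc (toℕ-inject₁ x)

nearPairs : ∀ n → List (Fin n × Fin n)
nearPairs 0 = []
nearPairs 1 = []
nearPairs 2 = (Fin.zero , Fin.suc Fin.zero) ∷ []
nearPairs (suc (suc (suc n))) =
  (Fin.zero , Fin.suc Fin.zero) ∷ (Fin.zero , Fin.suc (Fin.suc Fin.zero)) ∷
  map (Product.map Fin.suc Fin.suc) (nearPairs (suc (suc n)))

length-nearPairs : ∀ n → length (nearPairs n) ≤ 2 * n
length-nearPairs 0 = z≤n
length-nearPairs 1 = z≤n
length-nearPairs 2 = s≤s z≤n
length-nearPairs (suc (suc (suc n))) = begin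
  2 + length (map (Product.map Fin.suc Fin.suc) (nearPairs (suc (suc n))))
    ≡⟨ cong (2 +_) (length-map _ (nearPairs (suc (suc n)))) ⟩
  2 + length (nearPairs (suc (suc n)))
    ≤⟨ ℕ.+-monoʳ-≤ 2 (length-nearPairs (suc (suc n))) ⟩
  2 + 2 * (2 + n)
    ≡⟨ ℕ.*-suc 2 (2 + n) ⟨
  2 * (3 + n) ∎
  where open ℕ.≤-Reasoning

nearPairs-increasing : ∀ n → All (λ p → toℕ (proj₁ p) < toℕ (proj₂ p)) (nearPairs n)
nearPairs-increasing 0 = []
nearPairs-increasing 1 = []
nearPairs-increasing 2 = z<s ∷ []
nearPairs-increasing (suc (suc (suc n))) =
  z<s ∷ z<s ∷ map⁺ (All.map s<s (nearPairs-increasing (suc (suc n))))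

∈-nearPairs : ∀ {n} {k l : Fin n} → Near k l → (k , l) ∈ nearPairs n
∈-nearPairs {2} {Fin.zero} {Fin.suc Fin.zero} _ = here refl
∈-nearPairs {suc (suc (suc n))} {Fin.zero} {Fin.suc Fin.zero} _ = here refl
∈-nearPairs {suc (suc (suc n))} {Fin.zero} {Fin.suc (Fin.suc Fin.zero)} _ = there (here refl)
∈-nearPairs {suc (suc (suc n))} {Fin.suc k} {Fin.suc l} (s<s k<l , s≤s l≤2+k) =
  there (there (∈-map⁺ _ (∈-nearPairs (k<l , l≤2+k))))
∈-nearPairs {suc (suc (suc n))} {Fin.zero} {Fin.suc (Fin.suc (Fin.suc _))} (_ , s≤s (s≤s ()))
∈-nearPairs {2} {Fin.suc Fin.zero} {Fin.suc Fin.zero} (s<s () , _)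

module _ {n : ℕ} where

  permutation-injective : (π : Permutation′ n) {x y : Fin n} → π ⟨$⟩ʳ x ≡ π ⟨$⟩ʳ y → x ≡ y
  permutation-injective π = Injection.injective (↔⇒↣ π)

  flip∘ₚ≈id⇒≈ : (π π′ : Permutation′ n) → flip π ∘ₚ π′ ≈ id → π′ ≈ π
  flip∘ₚ≈id⇒≈ π π′ fixes i = begin
    π′ ⟨$⟩ʳ i                     ≡⟨ cong (π′ ⟨$⟩ʳ_) (inverseˡ π) ⟨
    π′ ⟨$⟩ʳ (π ⟨$⟩ˡ (π ⟨$⟩ʳ i))   ≡⟨ fixes (π ⟨$⟩ʳ i) ⟩
    π ⟨$⟩ʳ i                      ∎
    where open ≡-Reasoning

  Fixes : Permutation′ n → ℕ → Set
  Fixes π m = ∀ k → toℕ k < m → π ⟨$⟩ʳ k ≡ k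

  fixes-suc : ∀ π {m} → Fixes π m → (∀ k → toℕ k ≡ m → π ⟨$⟩ʳ k ≡ k) → Fixes π (suc m)
  fixes-suc π fix fix-m k k<1+m with ℕ.m<1+n⇒m<n∨m≡n k<1+m
  ... | inj₁ k<m = fix k k<m
  ... | inj₂ k≡m = fix-m k k≡m

  fixes-flip : ∀ π {m} → Fixes π m → Fixes (flip π) m
  fixes-flip π fix k k<m = begin
    π ⟨$⟩ˡ k                ≡⟨ cong (π ⟨$⟩ˡ_) (fix k k<m) ⟨
    π ⟨$⟩ˡ (π ⟨$⟩ʳ k)       ≡⟨ inverseˡ π ⟩
    k                       ∎
    where open ≡-Reasoning

  fixes⇒≥ : ∀ π {m k} → Fixes π m → m ≤ toℕ k → m ≤ toℕ (π ⟨$⟩ʳ k)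
  fixes⇒≥ π {m} {k} fix m≤k = ℕ.≮⇒≥ λ πk<m →
    ℕ.<⇒≱ (subst (λ x → toℕ x < m) (permutation-injective π (fix _ πk<m)) πk<m) m≤k

module _ {n : ℕ} (f g : Permutation′ n)
         (near : ∀ {k l} → Near k l → toℕ (f ⟨$⟩ʳ k) < toℕ (g ⟨$⟩ʳ l)) where

  private
    g-fixes-next : ∀ {m} → Fixes f m → Fixes g m → ∀ k → toℕ k ≡ m → g ⟨$⟩ʳ k ≡ k
    g-fixes-next f-fix g-fix k refl
      with ℕ.m≤n⇒m<n∨m≡n (fixes⇒≥ (flip g) {k = k} (fixes-flip g g-fix) ℕ.≤-refl)
    ... | inj₂ k≡x = trans (cong (g ⟨$⟩ʳ_) (toℕ-injective k≡x)) (inverseʳ g)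
    ... | inj₁ k<x = contradiction (near (near-by-one y+1≡x)) (ℕ.≤⇒≯ gx≤fy)
      where
      x = g ⟨$⟩ˡ k
      y = pred x
      y+1≡x : suc (toℕ y) ≡ toℕ x
      y+1≡x = suc-toℕ-pred x (ℕ.≤-trans (s≤s z≤n) k<x)
      gx≤fy : toℕ (g ⟨$⟩ʳ x) ≤ toℕ (f ⟨$⟩ʳ y)
      gx≤fy = subst (λ v → toℕ v ≤ toℕ (f ⟨$⟩ʳ y)) (sym (inverseʳ g))
                (fixes⇒≥ f f-fix (s≤s⁻¹ (subst (toℕ k <_) (sym y+1≡x) k<x)))

    column-next : ∀ {m z} → Fixes f m → toℕ (g ⟨$⟩ʳ z) ≡ suc m → suc m ≤ toℕ z →
                  toℕ z ≡ suc m
    column-next {m} {z} f-fix gz≡1+m 1+m≤z with ℕ.m≤n⇒m<n∨m≡n 1+m≤z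
    ... | inj₂ 1+m≡z = sym 1+m≡z
    ... | inj₁ 1+m<z = contradiction (cong toℕ (permutation-injective f fy≡fy′))
                                     (ℕ.<⇒≢ (ℕ.≤-reflexive y+1≡y′))
      where
      y′ = pred z
      y = pred y′
      y′+1≡z : suc (toℕ y′) ≡ toℕ z
      y′+1≡z = suc-toℕ-pred z (ℕ.≤-trans (s≤s z≤n) 1+m<z)
      1+m≤y′ : suc m ≤ toℕ y′
      1+m≤y′ = s≤s⁻¹ (subst (suc m <_) (sym y′+1≡z) 1+m<z)
      y+1≡y′ : suc (toℕ y) ≡ toℕ y′
      y+1≡y′ = suc-toℕ-pred y′ (ℕ.≤-trans (s≤s z≤n) 1+m≤y′)
      m≤y : m ≤ toℕ y
      m≤y = s≤s⁻¹ (subst (suc m ≤_) (sym y+1≡y′) 1+m≤y′)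
      row-value : ∀ {r} → m ≤ toℕ r → Near r z → toℕ (f ⟨$⟩ʳ r) ≡ m
      row-value m≤r r~z = ℕ.≤-antisym
        (s≤s⁻¹ (subst (toℕ (f ⟨$⟩ʳ _) <_) gz≡1+m (near r~z))) (fixes⇒≥ f f-fix m≤r)
      fy≡fy′ : f ⟨$⟩ʳ y ≡ f ⟨$⟩ʳ y′
      fy≡fy′ = toℕ-injective (trans
        (row-value m≤y (near-by-two (trans (cong suc y+1≡y′) y′+1≡z)))
        (sym (row-value (ℕ.≤-trans (ℕ.n≤1+n m) 1+m≤y′) (near-by-one y′+1≡z))))

    f-fixes-next : ∀ {m} → Fixes f m → Fixes g (suc m) → ∀ k → toℕ k ≡ m → f ⟨$⟩ʳ k ≡ k
    f-fixes-next {m} f-fix g-fix k refl =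
      toℕ-injective (ℕ.≤-antisym fk≤m (fixes⇒≥ f f-fix ℕ.≤-refl))
      where
      fk≤m : toℕ (f ⟨$⟩ʳ k) ≤ m
      fk≤m with suc m <? n
      ... | no 1+m≮n = s≤s⁻¹ (ℕ.<-≤-trans (toℕ<n (f ⟨$⟩ʳ k)) (ℕ.≮⇒≥ 1+m≮n))
      ... | yes 1+m<n = s≤s⁻¹ (subst (toℕ (f ⟨$⟩ʳ k) <_) gz≡1+m
                          (near (near-by-one (sym (column-next f-fix gz≡1+m 1+m≤z)))))
        where
        column = fromℕ< 1+m<n
        z = g ⟨$⟩ˡ column
        gz≡1+m : toℕ (g ⟨$⟩ʳ z) ≡ suc m
        gz≡1+m = trans (cong toℕ (inverseʳ g)) (toℕ-fromℕ< 1+m<n)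
        1+m≤z : suc m ≤ toℕ z
        1+m≤z = fixes⇒≥ (flip g) {k = column} (fixes-flip g g-fix)
                  (ℕ.≤-reflexive (sym (toℕ-fromℕ< 1+m<n)))

    fixes-below : ∀ m → Fixes f m × Fixes g m
    fixes-below zero = (λ _ ()) , (λ _ ())
    fixes-below (suc m) = fixes-suc f f-fix (f-fixes-next f-fix g-fix′) , g-fix′
      where
      f-fix = proj₁ (fixes-below m)
      g-fix′ = fixes-suc g (proj₂ (fixes-below m)) (g-fixes-next f-fix (proj₂ (fixes-below m)))

  near-ordered⇒≈id : f ≈ id × g ≈ id
  near-ordered⇒≈id = (λ k → proj₁ (fixes k) k ℕ.≤-refl) , (λ k → proj₂ (fixes k) k ℕ.≤-refl)
    where
    fixes : ∀ k → Fixes f (suc (toℕ k)) × Fixes g (suc (toℕ k))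
    fixes k = fixes-below (suc (toℕ k))

VanishesOn : ∀ {n} → Matrix n → List (Fin n × Fin n) → Set
VanishesOn M = All (λ p → M (proj₁ p) (proj₂ p) ≡ false)

module _ {n : ℕ} (σ τ : Permutation′ n) where

  certificate : List (Fin n × Fin n)
  certificate = map (λ p → σ ⟨$⟩ˡ proj₁ p , τ ⟨$⟩ˡ proj₂ p) (nearPairs n)

  length-certificate : length certificate ≤ 2 * n
  length-certificate = subst (_≤ 2 * n) (sym (length-map _ (nearPairs n))) (length-nearPairs n)

  permL-inverse : ∀ k l → permL n σ τ (σ ⟨$⟩ˡ k) (τ ⟨$⟩ˡ l) ≡ L n k l
  permL-inverse k l = cong₂ (L n) (inverseʳ σ) (inverseʳ τ)

  permL-vanishesOn-certificate : VanishesOn (permL n σ τ) certificate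
  permL-vanishesOn-certificate =
    map⁺ (All.map (λ k<l → trans (permL-inverse _ _) (<⇒L≡false k<l)) (nearPairs-increasing n))

  certificate-determines : (σ′ τ′ : Permutation′ n) → VanishesOn (permL n σ′ τ′) certificate →
                           ∀ i j → permL n σ′ τ′ i j ≡ permL n σ τ i j
  certificate-determines σ′ τ′ zeros i j =
    cong₂ (L n) (flip∘ₚ≈id⇒≈ σ σ′ (proj₁ fixed) i) (flip∘ₚ≈id⇒≈ τ τ′ (proj₂ fixed) j)
    where
    fixed : flip σ ∘ₚ σ′ ≈ id × flip τ ∘ₚ τ′ ≈ id
    fixed = near-ordered⇒≈id (flip σ ∘ₚ σ′) (flip τ ∘ₚ τ′)
              (λ k~l → L≡false⇒< (All.lookup (map⁻ zeros) (∈-nearPairs k~l)))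

lemmaB1 : ∃[ C ] ((n : ℕ) → 1 ≤ n → (σ τ : Permutation′ n) →
    ∃ λ (S : List (Fin n × Fin n)) → ((length S ≤ C * n)
    × All (λ p → permL n σ τ (proj₁ p) (proj₂ p) ≡ false) S
    × ((σ′ τ′ : Permutation′ n) →
    All (λ p → permL n σ′ τ′ (proj₁ p) (proj₂ p) ≡ false) S →
    (i j : Fin n) → permL n σ′ τ′ i j ≡ permL n σ τ i j)))
lemmaB1 = 2 , λ n _ σ τ →
  certificate σ τ , length-certificate σ τ ,
  permL-vanishesOn-certificate σ τ , certificate-determines σ τ
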